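{- Let $q$ be a stable natural number, $\eta=\delta(q)$, and $k$ a nonnegative integer. Then there is a substantial low-defect polynomial $f$ with leading coefficient $q$ such that $\delta(f)=\eta+k$ and $\deg f=k$.
   Context: $\|n\|$ denotes the integer complexity of $n\in\mathbb{N}$ (least number of $1$'s needed to write $n$ using $1$, $+$, $\cdot$ and parentheses); $\delta(n)=\|n\|-3\log_3 n$. $n$ is stable if $\|3^kn\|=3k+\|n\|$ for all $k\ge0$; the stable complexity is $\|n\|_{\mathrm{st}}=\|3^kn\|-3k$ for any $k$ with $3^kn$ stable. Low-defect pairs: the smallest subset $\mathscr{P}$ of $\mathbb{Z}[x_1,x_2,\ldots]\times\mathbb{N}$ such that (i) $(k,C)\in\mathscr{P}$ for constant $k\in\mathbb{N}$ and $C\ge\|k\|$; (ii) $(f_1,C_1),(f_2,C_2)\in\mathscr{P}$ implies $(f_1\otimes f_2,C_1+C_2)\in\mathscr{P}$, where $f_1\otimes f_2$ is the product after relabeling variables to be disjoint; (iii) $(f,C)\in\mathscr{P}$, $c\in\mathbb{N}$, $D\ge\|c\|$ imply $(f\cdot x+c,C+D)\in\mathscr{P}$ with $x$ a new variable. Low-defect polynomials are the first coordinates; such $f$ is multilinear, its degree equals its number of variables, and its leading coefficient $a$ (coefficient of the product of all variables) is nonzero. $\|f\|$ is the least $C$ with $(f,C)\in\mathscr{P}$; $\delta(f)=\|f\|-3\log_3 a$; $f$ is substantial if $\|f\|=\|a\|_{\mathrm{st}}+\deg f$. -}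

module Defs where

open import Data.Nat using (ℕ; zero; suc; _+_; _*_; _^_; _≤_)
open import Data.Product using (Σ; ∃; _×_; _,_)
open import Relation.Binary.PropositionalEquality using (_≡_)

data Expr : Set where
  one  : Expr
  _⊞_  : Expr → Expr → Expr
  _⊠_  : Expr → Expr → Expr

val : Expr → ℕ
val one     = 1
val (a ⊞ b) = val a + val b
val (a ⊠ b) = val a * val b

ones : Expr → ℕ
ones one     = 1
ones (a ⊞ b) = ones a + ones b
ones (a ⊠ b) = ones a + ones b

Cplx : ℕ → ℕ → Set
Cplx n c = (Σ Expr λ e → val e ≡ n × ones e ≡ c)
         × (∀ e → val e ≡ n → c ≤ ones e)

Stable : ℕ → Set
Stable n = ∀ k c → Cplx n c → Cplx (3 ^ k * n) (3 * k + c)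

StCplx : ℕ → ℕ → Set
StCplx n s = ∃ λ k → Stable (3 ^ k * n) × Cplx (3 ^ k * n) (3 * k + s)

-- Multilinear polynomials with natural coefficients in the variables
-- x₀ … x_{n-1}.  Poly (suc n) = pairs (g , h) representing g + h·x_n.

Poly : ℕ → Set
Poly zero    = ℕ
Poly (suc n) = Poly n × Poly n

constP : (n : ℕ) → ℕ → Poly n
constP zero    c = c
constP (suc n) c = constP n c , constP n 0

scaleP : {n : ℕ} → ℕ → Poly n → Poly n
scaleP {zero}  k a       = k * a
scaleP {suc n} k (g , h) = scaleP k g , scaleP k h

-- f₁ ⊗ f₂ : the variables x₀…x_{m-1} of f₁ are kept, the variables
-- x₀…x_{n-1} of f₂ are relabelled x_m … x_{m+n-1} (disjoint relabelling)
_⊗_ : {m n : ℕ} → Poly m → Poly n → Poly (n + m)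
_⊗_ {m} {zero}  f k       = scaleP k f
_⊗_ {m} {suc n} f (g , h) = (f ⊗ g) , (f ⊗ h)

linP : {n : ℕ} → Poly n → ℕ → Poly (suc n)
linP {n} f c = constP n c , f

-- leading coefficient: coefficient of x₀ x₁ ⋯ x_{n-1}
lead : {n : ℕ} → Poly n → ℕ
lead {zero}  a       = a
lead {suc n} (g , h) = lead h

data LDP : {n : ℕ} → Poly n → ℕ → Set where
  ldConst : ∀ {k C c} → Cplx k c → c ≤ C → LDP {zero} k C
  ldTimes : ∀ {m n} {f₁ : Poly m} {f₂ : Poly n} {C₁ C₂} →
            LDP f₁ C₁ → LDP f₂ C₂ → LDP (f₁ ⊗ f₂) (C₁ + C₂)
  ldLin   : ∀ {n} {f : Poly n} {C c d D} →
            LDP f C → Cplx c d → d ≤ D → LDP (linP f c) (C + D)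

LowDefect : {n : ℕ} → Poly n → Set
LowDefect f = ∃ λ C → LDP f C

PCplx : {n : ℕ} → Poly n → ℕ → Set
PCplx f C = LDP f C × (∀ C' → LDP f C' → C ≤ C')

-- f (with n variables, so deg f = n) is substantial: ‖f‖ = ‖a‖_st + deg f
Substantial : {n : ℕ} → Poly n → Set
Substantial {n} f = ∃ λ C → ∃ λ s → PCplx f C × StCplx (lead f) s × C ≡ s + n

-- The polynomial (⋯((q x₁ + 1) x₂ + 1) ⋯) x_k + 1 is built from q by k steps
-- (f ↦ f·x + 1), each of cost ‖1‖ = 1, so it has a construction of cost ‖q‖ + k.
-- Conversely, an induction over the rules building low-defect pairs shows that
-- every pair (f , C) admits an expression for the leading coefficient of f with
-- at most C − deg f ones: products multiply leading coefficients and add costs,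
-- and each new variable costs at least ‖c‖ ≥ 1 while keeping the leading
-- coefficient.  Hence ‖f‖ = ‖q‖ + k.  Stability of q gives ‖q‖_st = ‖q‖, so f
-- is substantial, and δ(f) = ‖q‖ + k − 3 log₃ q = δ(q) + k.
module Submission where

open import Defs
open import Data.Nat using (ℕ; zero; suc; _+_; _*_; _≤_; _<_; z≤n; s≤s; _≟_)
open import Data.Nat.Properties
open import Data.Nat.Induction using (<-rec)
open import Data.Nat.Tactic.RingSolver using (solve-∀)
open import Data.Product using (Σ; ∃; _×_; _,_; proj₁; proj₂)
open import Data.List using (List; []; _∷_; _++_; cartesianProductWith)
open import Data.List.Membership.Propositional using (_∈_; find; lose)
open import Data.List.Membership.Propositional.Properties
  using (∈-++⁺ˡ; ∈-++⁺ʳ; ∈-cartesianProductWith⁺)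
open import Data.List.Relation.Unary.Any using (here; there; any?)
open import Relation.Unary using (Pred; Decidable)
open import Relation.Nullary using (Dec; yes; no; contradiction)
open import Relation.Nullary.Decidable using (map′; _×-dec_)
open import Relation.Binary.PropositionalEquality
  using (_≡_; refl; sym; trans; cong; cong₂; subst; module ≡-Reasoning)

Least : ∀ {p} → Pred ℕ p → Set p
Least P = ∃ λ m → P m × (∀ {m′} → P m′ → m ≤ m′)

leastWitness : ∀ {p} {P : Pred ℕ p} → Decidable P → ∀ {n} → P n → Least P
leastWitness {P = P} P? {n} = <-rec (λ n → P n → Least P) step n
  where
  step : ∀ n → (∀ {m} → m < n → P m → Least P) → P n → Least P
  step n rec Pn with anyUpTo? P? n
  ... | yes (m , m<n , Pm) = rec m<n Pm
  ... | no none = n , Pn , λ Pm′ → ≮⇒≥ λ m′<n → none (_ , m′<n , Pm′)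

ones-positive : ∀ e → 1 ≤ ones e
ones-positive one     = ≤-refl
ones-positive (a ⊞ b) = ≤-trans (ones-positive a) (m≤m+n _ _)
ones-positive (a ⊠ b) = ≤-trans (ones-positive a) (m≤m+n _ _)

exprsWithin : ℕ → List Expr
exprsWithin zero    = []
exprsWithin (suc n) =
  one ∷ cartesianProductWith _⊞_ es es ++ cartesianProductWith _⊠_ es es
  where es = exprsWithin n

ones-split : ∀ a b {n} → ones a + ones b ≤ suc n → ones a ≤ n × ones b ≤ n
ones-split a b h =
    ≤-pred (≤-trans (subst (_≤ ones a + ones b) (+-comm (ones a) 1)
                            (+-monoʳ-≤ (ones a) (ones-positive b))) h)
  , ≤-pred (≤-trans (+-monoˡ-≤ (ones b) (ones-positive a)) h)

∈-exprsWithin : ∀ e {n} → ones e ≤ n → e ∈ exprsWithin n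
∈-exprsWithin e {zero} h = contradiction (≤-trans (ones-positive e) h) λ ()
∈-exprsWithin one     {suc n} h = here refl
∈-exprsWithin (a ⊞ b) {suc n} h =
  let ha , hb = ones-split a b h in
  there (∈-++⁺ˡ (∈-cartesianProductWith⁺ _⊞_ (∈-exprsWithin a ha) (∈-exprsWithin b hb)))
∈-exprsWithin (a ⊠ b) {suc n} h =
  let ha , hb = ones-split a b h in
  there (∈-++⁺ʳ _ (∈-cartesianProductWith⁺ _⊠_ (∈-exprsWithin a ha) (∈-exprsWithin b hb)))

Represents : ℕ → ℕ → Set
Represents n c = Σ Expr λ e → val e ≡ n × ones e ≡ c

represents? : ∀ n c → Dec (Represents n c)
represents? n c =
  map′ (λ any → let e , _ , p = find any in e , p)
       (λ (e , p) → lose (∈-exprsWithin e (≤-reflexive (proj₂ p))) p)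
       (any? (λ e → (val e ≟ n) ×-dec (ones e ≟ c)) (exprsWithin c))

unaryExpr : ∀ n → 1 ≤ n → Σ Expr λ e → val e ≡ n
unaryExpr (suc zero)    _ = one , refl
unaryExpr (suc (suc n)) _ = let e , v = unaryExpr (suc n) (s≤s z≤n) in one ⊞ e , cong suc v

complexity : ∀ n → 1 ≤ n → ∃ (Cplx n)
complexity n n≥1 =
  let e , v = unaryExpr n n≥1
      c , rep , least = leastWitness (represents? n) (e , v , refl)
  in c , rep , λ e′ v′ → least (e′ , v′ , refl)

lead-scaleP : ∀ {n} k (f : Poly n) → lead (scaleP k f) ≡ k * lead f
lead-scaleP {zero}  k a       = refl
lead-scaleP {suc n} k (g , h) = lead-scaleP k h

lead-⊗ : ∀ {m n} (f₁ : Poly m) (f₂ : Poly n) → lead (f₁ ⊗ f₂) ≡ lead f₁ * lead f₂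
lead-⊗ {n = zero}  f₁ a       = trans (lead-scaleP a f₁) (*-comm a (lead f₁))
lead-⊗ {n = suc n} f₁ (g , h) = lead-⊗ f₁ h

LDP⇒leadExpr : ∀ {n} {f : Poly n} {C} → LDP f C →
               Σ Expr λ e → val e ≡ lead f × ones e + n ≤ C
LDP⇒leadExpr (ldConst ((e , v , o) , _) c≤C) =
  e , v , ≤-trans (≤-reflexive (trans (+-identityʳ _) o)) c≤C
LDP⇒leadExpr (ldTimes {m} {n} {f₁} {f₂} l₁ l₂) =
  let e₁ , v₁ , o₁ = LDP⇒leadExpr l₁
      e₂ , v₂ , o₂ = LDP⇒leadExpr l₂
  in e₁ ⊠ e₂ , trans (cong₂ _*_ v₁ v₂) (sym (lead-⊗ f₁ f₂))
     , ≤-trans (≤-reflexive (rearrange (ones e₁) (ones e₂) n m)) (+-mono-≤ o₁ o₂)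
  where
  rearrange : ∀ a b n m → a + b + (n + m) ≡ a + m + (b + n)
  rearrange = solve-∀
LDP⇒leadExpr (ldLin {n} {C = C} {D = D} l ((e₀ , _ , o₀) , _) d≤D) =
  let e , v , o = LDP⇒leadExpr l
      1≤D = ≤-trans (subst (1 ≤_) o₀ (ones-positive e₀)) d≤D
  in e , v , (begin
    ones e + suc n   ≡⟨ +-suc (ones e) n ⟩
    suc (ones e + n) ≡⟨ +-comm 1 (ones e + n) ⟩
    ones e + n + 1   ≤⟨ +-mono-≤ o 1≤D ⟩
    C + D            ∎)
  where open ≤-Reasoning

Cplx-lead+deg≤ : ∀ {n} {f : Poly n} {C c} → Cplx (lead f) c → LDP f C → c + n ≤ C
Cplx-lead+deg≤ {n} (_ , least) l =
  let e , v , o = LDP⇒leadExpr l in ≤-trans (+-monoˡ-≤ n (least e v)) o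

nestedLinear : ℕ → (k : ℕ) → Poly k
nestedLinear q zero    = q
nestedLinear q (suc k) = linP (nestedLinear q k) 1

lead-nestedLinear : ∀ q k → lead (nestedLinear q k) ≡ q
lead-nestedLinear q zero    = refl
lead-nestedLinear q (suc k) = lead-nestedLinear q k

Cplx-1 : Cplx 1 1
Cplx-1 = (one , refl , refl) , λ e _ → ones-positive e

LDP-nestedLinear : ∀ {q c} → Cplx q c → ∀ k → LDP (nestedLinear q k) (c + k)
LDP-nestedLinear {c = c} ‖q‖ zero =
  subst (LDP _) (sym (+-identityʳ c)) (ldConst ‖q‖ ≤-refl)
LDP-nestedLinear {c = c} ‖q‖ (suc k) =
  subst (LDP _) (sym (+-suc c k)) (subst (LDP _) (+-comm (c + k) 1)
    (ldLin (LDP-nestedLinear ‖q‖ k) Cplx-1 ≤-refl))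

PCplx-nestedLinear : ∀ {q c} → Cplx q c → ∀ k → PCplx (nestedLinear q k) (c + k)
PCplx-nestedLinear {q} {c} ‖q‖ k =
    LDP-nestedLinear ‖q‖ k
  , λ _ l → Cplx-lead+deg≤ (subst (λ a → Cplx a c) (sym (lead-nestedLinear q k)) ‖q‖) l

Stable⇒StCplx : ∀ {n c} → Stable n → Cplx n c → StCplx n c
Stable⇒StCplx {n} {c} st ‖n‖ =
  0 , subst Stable (sym (*-identityˡ n)) st , subst (λ a → Cplx a c) (sym (*-identityˡ n)) ‖n‖

proposition3p6 : (q : ℕ) → 1 ≤ q → Stable q → (k : ℕ) →
    Σ (Poly k) λ f → LowDefect f × Substantial f × lead f ≡ q ×
      (∃ λ C → ∃ λ c → PCplx f C × Cplx q c × C ≡ c + k)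
proposition3p6 q q≥1 st k =
    f , (c + k , proj₁ ‖f‖) , (c + k , c , ‖f‖ , ‖a‖st , refl) , lead-f
  , (c + k , c , ‖f‖ , ‖q‖ , refl)
  where
  f : Poly k
  f = nestedLinear q k
  lead-f : lead f ≡ q
  lead-f = lead-nestedLinear q k
  c : ℕ
  c = proj₁ (complexity q q≥1)
  ‖q‖ : Cplx q c
  ‖q‖ = proj₂ (complexity q q≥1)
  ‖f‖ : PCplx f (c + k)
  ‖f‖ = PCplx-nestedLinear ‖q‖ k
  ‖a‖st : StCplx (lead f) c
  ‖a‖st = subst (λ a → StCplx a c) (sym lead-f) (Stable⇒StCplx st ‖q‖)
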